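{- Let $g(X)\in\mathbb{F}_2[X_1,\dots,X_k]$. The following are equivalent: (1) $g$ has degree at most $2$; (2) for all $\alpha\neq\beta$ in $\mathbb{F}_2^k$, there is at most one $\gamma\in\mathbb{F}_2^k$ such that $\#(g_{\alpha,\beta,\gamma}(X))\in\{0,2^k\}$, and for all $\gamma'$ other than such a $\gamma$ we have $\#(g_{\alpha,\beta,\gamma'}(X))=2^{k-1}$.
   Context: Polynomials over $\mathbb{F}_2$ are written as sums (with $\oplus$ denoting addition in $\mathbb{F}_2$) of distinct multilinear monomials $X_{i_1}\cdots X_{i_j}$ with $1\le i_1<\dots<i_j\le k$; the degree refers to this representation. For a polynomial $f(X)$, $\#(f(X))=|\{a\in\mathbb{F}_2^k\mid f(a)=1\}|$. For $\alpha,\beta,\gamma\in\mathbb{F}_2^k$, $g_{\alpha,\beta,\gamma}(X)=g(\alpha\oplus X)\oplus g(\beta\oplus X)\oplus\gamma\cdot X$, where $\gamma\cdot X=\bigoplus_i\gamma_iX_i$. -}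

module Defs where

open import Data.Bool using (Bool; true; false; _∧_; _∨_; not; _xor_)
open import Data.Nat using (ℕ; zero; suc; _≤_; _^_; _∸_)
open import Data.List using (List; []; _∷_; _++_; map; foldr; length; filter)
open import Data.Vec using (Vec; []; _∷_; zipWith; count)
open import Data.Sum using (_⊎_)
open import Relation.Binary.PropositionalEquality using (_≡_)
open import Data.Bool.Properties using (T?)

-- Points of F₂^k, with F₂ = Bool (false = 0, true = 1, xor = addition, ∧ = multiplication).
Pt : ℕ → Set
Pt k = Vec Bool k

allPts : (k : ℕ) → List (Pt k)
allPts zero = [] ∷ []
allPts (suc k) = map (false ∷_) (allPts k) ++ map (true ∷_) (allPts k)

-- A multilinear monomial X_{i₁}⋯X_{iⱼ} is identified with its support S ⊆ {1..k},
-- given as a characteristic vector.  A polynomial of F₂[X₁..X_k] in the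
-- multilinear representation is the function assigning to each monomial its
-- coefficient in F₂ (i.e. the set of monomials occurring in the sum).
Poly : ℕ → Set
Poly k = Pt k → Bool

monoDeg : {k : ℕ} → Pt k → ℕ
monoDeg S = count T? S

monoEval : {k : ℕ} → Pt k → Pt k → Bool
monoEval [] [] = true
monoEval (s ∷ S) (x ∷ a) = (not s ∨ x) ∧ monoEval S a

eval : {k : ℕ} → Poly k → Pt k → Bool
eval {k} g a = foldr _xor_ false (map (λ S → g S ∧ monoEval S a) (allPts k))

DegreeAtMost : {k : ℕ} → ℕ → Poly k → Set
DegreeAtMost d g = ∀ S → g S ≡ true → monoDeg S ≤ d

_⊕_ : {k : ℕ} → Pt k → Pt k → Pt k
_⊕_ = zipWith _xor_

dot : {k : ℕ} → Pt k → Pt k → Bool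
dot [] [] = false
dot (c ∷ γ) (x ∷ a) = (c ∧ x) xor dot γ a

#_ : {k : ℕ} → (Pt k → Bool) → ℕ
#_ {k} f = length (filter (λ a → T? (f a)) (allPts k))

gabc : {k : ℕ} → Poly k → Pt k → Pt k → Pt k → Pt k → Bool
gabc g α β γ x = (eval g (α ⊕ x) xor eval g (β ⊕ x)) xor dot γ x

Extreme : {k : ℕ} → Poly k → Pt k → Pt k → Pt k → Set
Extreme {k} g α β γ = (# gabc g α β γ ≡ 0) ⊎ (# gabc g α β γ ≡ 2 ^ k)

module Submission where

-- Write Δ g α β = g(α ⊕ X) ⊕ g(β ⊕ X), so that g_{α,β,γ} = Δ g α β ⊕ γ·X is a
-- "twist" of the derivative Δ g α β.  Both sides of the theorem are equivalent
-- to "every Δ g α β is affine":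
--  * Spectral side (for any h : F₂^k → F₂, k ≥ 1): h is affine iff at most one
--    twist of h has extreme count and all others are balanced.  If h = L·X ⊕ c,
--    its twists are the affine forms (L ⊕ γ)·X ⊕ c, and nonzero forms are
--    balanced.  Conversely, a function all of whose nontrivial twists are
--    balanced is constant (induction on k), which yields the linear part.
--  * Degree side: splitting off X₁ as g = low g ⊕ X₁ · high g, an induction on k
--    climbs the ladders  deg ≤ 0 ⇒ constant ⇒ deg ≤ 1 ⇒ affine ⇒ deg ≤ 2 ⇒
--    affine derivatives, and back down  constant ⇒ deg ≤ 0, constant
--    derivatives ⇒ deg ≤ 1, affine derivatives ⇒ deg ≤ 2.
-- The file develops vectors and affine functions, counting, the spectral
-- characterisation, the polynomial ladders, and finally the theorem.

open import Defs
open import Data.Nat using (ℕ; _^_; _∸_)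
open import Data.Product using (_×_)
open import Function.Bundles using (_⇔_)
open import Relation.Binary.PropositionalEquality using (_≡_; _≢_)
open import Relation.Nullary using (¬_)

open import Algebra.Properties.CommutativeSemigroup using (interchange)
open import Data.Bool using (Bool; true; false; _∧_; not; _xor_; T)
open import Data.Bool.Properties using (T?; _≟_; xor-same; xor-identityʳ; xor-identityˡ; xor-assoc; xor-comm; not-distribʳ-xor; not-distribˡ-xor; ∧-zeroʳ; ∧-distribˡ-xor)
open import Data.Bool.Solver using (module xor-∧-Solver)
open import Data.Empty using (⊥-elim)
open import Data.List using (List; []; _∷_; _++_; map; filter; length; foldr)
open import Data.List.Membership.Propositional using (_∈_; lose)
open import Data.List.Membership.Propositional.Properties using (∈-map⁺; ∈-++⁺ˡ; ∈-++⁺ʳ)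
open import Data.List.Properties using (map-∘; map-cong; length-++; filter-++; filter-none; filter-≐)
import Data.List.Relation.Unary.All as All
open import Data.List.Relation.Unary.Any using (here; any?; satisfied)
open import Data.Nat using (zero; suc; _+_; _*_; z≤n; s≤s; s≤s⁻¹; ≢-nonZero⁻¹) renaming (_≟_ to _≟ℕ_)
open import Data.Nat.Properties using (+-identityʳ; +-comm; +-cancelˡ-≡; +-cancelʳ-≡; *-cancelˡ-≡; m^n≢0; m+n≡0⇒m≡0; +-commutativeSemigroup)
open import Data.Product using (Σ; _,_; proj₁; proj₂)
open import Data.Sum using (_⊎_; inj₁; inj₂)
open import Data.Vec using ([]; _∷_; replicate; tail)
import Data.Vec as Vec
open import Data.Vec.Properties using (≡-dec; zipWith-assoc; zipWith-identityˡ; zipWith-identityʳ)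
open import Function using (_∘_)
open import Function.Bundles using (mk⇔)
open import Relation.Binary.PropositionalEquality using (refl; sym; trans; cong; cong₂; subst; module ≡-Reasoning)
open import Relation.Nullary using (Dec; yes; no)
open import Relation.Nullary.Decidable using (_⊎-dec_)

open xor-∧-Solver using (solve; _:=_; _:+_; _:*_; con)
open ≡-Reasoning

𝟘 : (k : ℕ) → Pt k
𝟘 k = replicate k false

⊕-self : ∀ {k} (x : Pt k) → x ⊕ x ≡ 𝟘 k
⊕-self [] = refl
⊕-self (a ∷ x) = cong₂ _∷_ (xor-same a) (⊕-self x)

⊕-cancelˡ : ∀ {k} (x y z : Pt k) → x ⊕ y ≡ x ⊕ z → y ≡ z
⊕-cancelˡ {k} x y z eq = begin
  y              ≡⟨ sym (zipWith-identityˡ xor-identityˡ y) ⟩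
  𝟘 k ⊕ y        ≡⟨ cong (_⊕ y) (sym (⊕-self x)) ⟩
  (x ⊕ x) ⊕ y    ≡⟨ zipWith-assoc xor-assoc x x y ⟩
  x ⊕ (x ⊕ y)    ≡⟨ cong (x ⊕_) eq ⟩
  x ⊕ (x ⊕ z)    ≡⟨ sym (zipWith-assoc xor-assoc x x z) ⟩
  (x ⊕ x) ⊕ z    ≡⟨ cong (_⊕ z) (⊕-self x) ⟩
  𝟘 k ⊕ z        ≡⟨ zipWith-identityˡ xor-identityˡ z ⟩
  z              ∎

dot-𝟘 : ∀ {k} (x : Pt k) → dot (𝟘 k) x ≡ false
dot-𝟘 [] = refl
dot-𝟘 (_ ∷ x) = dot-𝟘 x

dot-⊕ˡ : ∀ {k} (L M x : Pt k) → dot (L ⊕ M) x ≡ dot L x xor dot M x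
dot-⊕ˡ [] [] [] = refl
dot-⊕ˡ (l ∷ L) (m ∷ M) (y ∷ x) = begin
  ((l xor m) ∧ y) xor dot (L ⊕ M) x         ≡⟨ cong (((l xor m) ∧ y) xor_) (dot-⊕ˡ L M x) ⟩
  ((l xor m) ∧ y) xor (dot L x xor dot M x)
    ≡⟨ solve 5 (λ l m y d e → ((l :+ m) :* y) :+ (d :+ e) := ((l :* y) :+ d) :+ ((m :* y) :+ e))
               refl l m y (dot L x) (dot M x) ⟩
  ((l ∧ y) xor dot L x) xor ((m ∧ y) xor dot M x) ∎

dot-⊕ʳ : ∀ {k} (L u v : Pt k) → dot L (u ⊕ v) ≡ dot L u xor dot L v
dot-⊕ʳ [] [] [] = refl
dot-⊕ʳ (l ∷ L) (a ∷ u) (b ∷ v) = begin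
  (l ∧ (a xor b)) xor dot L (u ⊕ v)         ≡⟨ cong ((l ∧ (a xor b)) xor_) (dot-⊕ʳ L u v) ⟩
  (l ∧ (a xor b)) xor (dot L u xor dot L v)
    ≡⟨ solve 5 (λ l a b d e → (l :* (a :+ b)) :+ (d :+ e) := ((l :* a) :+ d) :+ ((l :* b) :+ e))
               refl l a b (dot L u) (dot L v) ⟩
  ((l ∧ a) xor dot L u) xor ((l ∧ b) xor dot L v) ∎

scale : ∀ {k} → Bool → Pt k → Pt k
scale s = Vec.map (s ∧_)

dot-scale : ∀ {k} (s : Bool) (L x : Pt k) → dot (scale s L) x ≡ s ∧ dot L x
dot-scale s [] [] = sym (∧-zeroʳ s)
dot-scale s (l ∷ L) (y ∷ x) = begin
  ((s ∧ l) ∧ y) xor dot (scale s L) x ≡⟨ cong (((s ∧ l) ∧ y) xor_) (dot-scale s L x) ⟩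
  ((s ∧ l) ∧ y) xor (s ∧ dot L x)
    ≡⟨ solve 4 (λ s l y d → ((s :* l) :* y) :+ (s :* d) := s :* ((l :* y) :+ d)) refl s l y (dot L x) ⟩
  s ∧ ((l ∧ y) xor dot L x)           ∎

-- allPts enumerates every point of F₂^k; this makes existence of a twist with a
-- given decidable property decidable.
allPts-complete : ∀ {k} (x : Pt k) → x ∈ allPts k
allPts-complete [] = here refl
allPts-complete (false ∷ x) = ∈-++⁺ˡ (∈-map⁺ (false ∷_) (allPts-complete x))
allPts-complete {suc k} (true ∷ x) = ∈-++⁺ʳ (map (false ∷_) (allPts k)) (∈-map⁺ (true ∷_) (allPts-complete x))

Constant : {A : Set} → (A → Bool) → Set
Constant {A} h = Σ Bool λ c → ∀ x → h x ≡ c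

twist : {k : ℕ} → (Pt k → Bool) → Pt k → Pt k → Bool
twist h γ x = h x xor dot γ x

Affine : {k : ℕ} → (Pt k → Bool) → Set
Affine {k} h = Σ (Pt k) λ L → Constant (twist h L)

constant-on-Pt0 : (h : Pt 0 → Bool) → Constant h
constant-on-Pt0 h = h [] , λ { [] → refl }

affine-on-Pt0 : (h : Pt 0 → Bool) → Affine h
affine-on-Pt0 h = [] , constant-on-Pt0 (twist h [])

affine-cong : ∀ {k} {h h′ : Pt k → Bool} → (∀ x → h x ≡ h′ x) → Affine h′ → Affine h
affine-cong h≡h′ (L , c , h′L≡c) = L , c , λ x → trans (cong (_xor dot L x) (h≡h′ x)) (h′L≡c x)

twist-twist : ∀ {k} (h : Pt k → Bool) (γ δ x : Pt k) → twist (twist h γ) δ x ≡ twist h (γ ⊕ δ) x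
twist-twist h γ δ x = begin
  (h x xor dot γ x) xor dot δ x ≡⟨ xor-assoc (h x) _ _ ⟩
  h x xor (dot γ x xor dot δ x) ≡⟨ cong (h x xor_) (sym (dot-⊕ˡ γ δ x)) ⟩
  h x xor dot (γ ⊕ δ) x         ∎

twist-affine : ∀ {k} (h : Pt k → Bool) (L : Pt k) {c : Bool} → (∀ x → twist h L x ≡ c) →
               ∀ γ x → twist h γ x ≡ dot (L ⊕ γ) x xor c
twist-affine h L {c} hL≡c γ x = begin
  h x xor dot γ x
    ≡⟨ solve 3 (λ p l g → p :+ g := (p :+ l) :+ (l :+ g)) refl (h x) (dot L x) (dot γ x) ⟩
  (h x xor dot L x) xor (dot L x xor dot γ x) ≡⟨ cong₂ _xor_ (hL≡c x) (sym (dot-⊕ˡ L γ x)) ⟩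
  c xor dot (L ⊕ γ) x                      ≡⟨ xor-comm c _ ⟩
  dot (L ⊕ γ) x xor c                      ∎

affine-translate : ∀ {k} (h : Pt k → Bool) (L : Pt k) {c : Bool} → (∀ x → twist h L x ≡ c) →
                   ∀ u x → h (u ⊕ x) ≡ dot L x xor (dot L u xor c)
affine-translate h L {c} hL≡c u x = begin
  h (u ⊕ x)
    ≡⟨ solve 2 (λ e d → e := (e :+ d) :+ d) refl (h (u ⊕ x)) (dot L (u ⊕ x)) ⟩
  twist h L (u ⊕ x) xor dot L (u ⊕ x)           ≡⟨ cong₂ _xor_ (hL≡c (u ⊕ x)) (dot-⊕ʳ L u x) ⟩
  c xor (dot L u xor dot L x)
    ≡⟨ solve 3 (λ c a b → c :+ (a :+ b) := b :+ (a :+ c)) refl c (dot L u) (dot L x) ⟩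
  dot L x xor (dot L u xor c)                   ∎

affine-restrict : ∀ {k} (h : Pt (suc k) → Bool) → Affine h → Affine (h ∘ (false ∷_))
affine-restrict h (l ∷ L , c , hL≡c) = L , c , λ x →
  trans (cong (λ d → h (false ∷ x) xor (d xor dot L x)) (sym (∧-zeroʳ l))) (hL≡c (false ∷ x))

affine-difference : ∀ {k} (h : Pt (suc k) → Bool) → Affine h → Constant (λ x → h (false ∷ x) xor h (true ∷ x))
affine-difference h (l ∷ L , c , hL≡c) = l , λ x → begin
  h (false ∷ x) xor h (true ∷ x)
    ≡⟨ solve 4 (λ u v l d → u :+ v := ((u :+ ((l :* con false) :+ d)) :+ (v :+ ((l :* con true) :+ d))) :+ l)
             refl (h (false ∷ x)) (h (true ∷ x)) l (dot L x) ⟩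
  (twist h (l ∷ L) (false ∷ x) xor twist h (l ∷ L) (true ∷ x)) xor l
    ≡⟨ cong (_xor l) (cong₂ _xor_ (hL≡c (false ∷ x)) (hL≡c (true ∷ x))) ⟩
  (c xor c) xor l
    ≡⟨ cong (_xor l) (xor-same c) ⟩
  l ∎

count-map : {A B : Set} (h : B → Bool) (f : A → B) (xs : List A) →
            length (filter (T? ∘ h) (map f xs)) ≡ length (filter (T? ∘ h ∘ f) xs)
count-map h f [] = refl
count-map h f (x ∷ xs) with h (f x)
... | true = cong suc (count-map h f xs)
... | false = count-map h f xs

#-cong : ∀ {k} {h h′ : Pt k → Bool} → (∀ x → h x ≡ h′ x) → # h ≡ # h′
#-cong {k} eq = cong length (filter-≐ (T? ∘ _) (T? ∘ _)
  ((λ {x} → subst T (eq x)) , (λ {x} → subst T (sym (eq x)))) (allPts k))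

#-split : ∀ {k} (h : Pt (suc k) → Bool) → # h ≡ # (h ∘ (false ∷_)) + # (h ∘ (true ∷_))
#-split {k} h = begin
  length (filter P (xs₀ ++ xs₁))              ≡⟨ cong length (filter-++ P xs₀ xs₁) ⟩
  length (filter P xs₀ ++ filter P xs₁)       ≡⟨ length-++ (filter P xs₀) ⟩
  length (filter P xs₀) + length (filter P xs₁) ≡⟨ cong₂ _+_ (count-map h _ (allPts k)) (count-map h _ (allPts k)) ⟩
  # (h ∘ (false ∷_)) + # (h ∘ (true ∷_))     ∎
  where
  P = T? ∘ h
  xs₀ = map (false ∷_) (allPts k)
  xs₁ = map (true ∷_) (allPts k)

#-false : ∀ {k} (h : Pt k → Bool) → (∀ x → h x ≡ false) → # h ≡ 0
#-false {k} h hf = cong length (filter-none (T? ∘ h) {allPts k} (All.tabulate λ {x} _ → subst T (hf x)))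

#-not : ∀ k (h : Pt k → Bool) → # (not ∘ h) + # h ≡ 2 ^ k
#-not zero h with h []
... | true = refl
... | false = refl
#-not (suc k) h = begin
  # (not ∘ h) + # h                           ≡⟨ cong₂ _+_ (#-split (not ∘ h)) (#-split h) ⟩
  (# (not ∘ h₀) + # (not ∘ h₁)) + (# h₀ + # h₁) ≡⟨ interchange +-commutativeSemigroup (# (not ∘ h₀)) _ _ _ ⟩
  (# (not ∘ h₀) + # h₀) + (# (not ∘ h₁) + # h₁) ≡⟨ cong₂ _+_ (#-not k h₀) (#-not k h₁) ⟩
  2 ^ k + 2 ^ k                               ≡⟨ cong (2 ^ k +_) (sym (+-identityʳ _)) ⟩
  2 ^ suc k                                   ∎
  where
  h₀ = h ∘ (false ∷_)
  h₁ = h ∘ (true ∷_)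

#-true : ∀ {k} (h : Pt k → Bool) → (∀ x → h x ≡ true) → # h ≡ 2 ^ k
#-true {k} h ht = trans (cong (_+ # h) (sym (#-false (not ∘ h) (λ x → cong not (ht x))))) (#-not k h)

ExtremeCount : {k : ℕ} → (Pt k → Bool) → Set
ExtremeCount {k} h = (# h ≡ 0) ⊎ (# h ≡ 2 ^ k)

Balanced : {k : ℕ} → (Pt k → Bool) → Set
Balanced {k} h = 2 * # h ≡ 2 ^ k

2^≢0 : ∀ m → 2 ^ m ≢ 0
2^≢0 m = ≢-nonZero⁻¹ (2 ^ m) {{m^n≢0 2 m}}

balanced⇒half : ∀ {m} (h : Pt (suc m) → Bool) → Balanced h → # h ≡ 2 ^ m
balanced⇒half {m} h = *-cancelˡ-≡ (# h) (2 ^ m) 2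

balanced-cong : ∀ {k} {h h′ : Pt k → Bool} → (∀ x → h x ≡ h′ x) → Balanced h′ → Balanced h
balanced-cong eq = trans (cong (2 *_) (#-cong eq))

constant⇒extreme : ∀ {k} {h : Pt k → Bool} → Constant h → ExtremeCount h
constant⇒extreme {h = h} (false , hc) = inj₁ (#-false h hc)
constant⇒extreme {h = h} (true , hc) = inj₂ (#-true h hc)

balanced⇒¬extreme : ∀ {m} (h : Pt (suc m) → Bool) → Balanced h → ¬ ExtremeCount h
balanced⇒¬extreme {m} h b (inj₁ #h≡0) = 2^≢0 m (trans (sym (balanced⇒half h b)) #h≡0)
balanced⇒¬extreme {m} h b (inj₂ #h≡2^k) = 2^≢0 m (m+n≡0⇒m≡0 (2 ^ m) (+-cancelˡ-≡ (2 ^ m) (2 ^ m + 0) 0 (begin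
  2 ^ m + (2 ^ m + 0) ≡⟨ sym #h≡2^k ⟩
  # h                 ≡⟨ balanced⇒half h b ⟩
  2 ^ m               ≡⟨ sym (+-identityʳ _) ⟩
  2 ^ m + 0           ∎)))

extreme? : ∀ {k} (h : Pt k → Bool) → Dec (ExtremeCount h)
extreme? {k} h = (# h ≟ℕ 0) ⊎-dec (# h ≟ℕ 2 ^ k)

-- Every nonzero affine form δ·X ⊕ c is balanced.  If δ₁ = 1 the two halves are
-- complementary; otherwise both halves are the same form in one variable less.
linear-balanced : ∀ {k} (δ : Pt k) (c : Bool) → δ ≢ 𝟘 k → Balanced (λ x → dot δ x xor c)
linear-balanced [] c δ≢𝟘 = ⊥-elim (δ≢𝟘 refl)
linear-balanced {suc m} (true ∷ δ) c _ = cong (2 *_) (begin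
  # ℓ                                     ≡⟨ #-split ℓ ⟩
  # ℓ′ + # (λ x → not (dot δ x) xor c)  ≡⟨ cong (# ℓ′ +_) (#-cong λ x → sym (not-distribˡ-xor (dot δ x) c)) ⟩
  # ℓ′ + # (not ∘ ℓ′)                   ≡⟨ +-comm (# ℓ′) _ ⟩
  # (not ∘ ℓ′) + # ℓ′                   ≡⟨ #-not m ℓ′ ⟩
  2 ^ m                                   ∎)
  where
  ℓ = λ x → dot (true ∷ δ) x xor c
  ℓ′ = λ x → dot δ x xor c
linear-balanced {suc m} (false ∷ δ) c δ≢𝟘 = cong (2 *_) (begin
  # ℓ          ≡⟨ #-split ℓ ⟩
  # ℓ′ + # ℓ′  ≡⟨ cong (# ℓ′ +_) (sym (+-identityʳ _)) ⟩
  2 * # ℓ′     ≡⟨ linear-balanced δ c (δ≢𝟘 ∘ cong (false ∷_)) ⟩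
  2 ^ m        ∎)
  where
  ℓ = λ x → dot (false ∷ δ) x xor c
  ℓ′ = λ x → dot δ x xor c

-- Arithmetic used to pass balance down to the halves.
equal-thirds : ∀ {A B B′ M} → A + B ≡ M → A + B′ ≡ M → B′ + B ≡ M → (2 * A ≡ M) × (2 * B ≡ M)
equal-thirds {A} {B} {B′} {M} e₁ e₂ e₃ = trans (cong (2 *_) A≡B) 2B≡M , 2B≡M
  where
  B≡B′ : B ≡ B′
  B≡B′ = +-cancelˡ-≡ A B B′ (trans e₁ (sym e₂))
  B+B≡M : B + B ≡ M
  B+B≡M = trans (cong (_+ B) B≡B′) e₃
  2B≡M : 2 * B ≡ M
  2B≡M = trans (cong (B +_) (+-identityʳ B)) B+B≡M
  A≡B : A ≡ B
  A≡B = +-cancelʳ-≡ B A B (trans e₁ (sym B+B≡M))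

halves-agree : ∀ m (a b : Bool) → # (λ (_ : Pt m) → a) + # (λ (_ : Pt m) → not b) ≡ 2 ^ m → a ≡ b
halves-agree m false false _ = refl
halves-agree m true true _ = refl
halves-agree m false true e =
  ⊥-elim (2^≢0 m (trans (sym e) (cong₂ _+_ (#-false {m} _ λ _ → refl) (#-false {m} _ λ _ → refl))))
halves-agree m true false e =
  ⊥-elim (2^≢0 m (+-cancelʳ-≡ (2 ^ m) (2 ^ m) 0
    (trans (sym (cong₂ _+_ (#-true {m} _ λ _ → refl) (#-true {m} _ λ _ → refl))) e)))

-- Induction on k: the twists by (0,δ) and (1,δ) show that
-- the twists of both halves of f are balanced, so both halves are constant,
-- and the twist by (1,0,…,0) forces the two constants to agree.
balanced-twists⇒constant : ∀ k (f : Pt k → Bool) → (∀ δ → δ ≢ 𝟘 k → Balanced (twist f δ)) → Constant f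
balanced-twists⇒constant zero f _ = constant-on-Pt0 f
balanced-twists⇒constant (suc m) f balanced =
  a , λ { (false ∷ x) → f₀≡a x ; (true ∷ x) → trans (f₁≡b x) (sym a≡b) }
  where
  f₀ f₁ : Pt m → Bool
  f₀ = f ∘ (false ∷_)
  f₁ = f ∘ (true ∷_)
  halves : ∀ δ → δ ≢ 𝟘 m → Balanced (twist f₀ δ) × Balanced (twist f₁ δ)
  halves δ δ≢𝟘 = equal-thirds {# (twist f₀ δ)} {# (twist f₁ δ)} e₁ e₂ (#-not m (twist f₁ δ))
    where
    e₁ : # (twist f₀ δ) + # (twist f₁ δ) ≡ 2 ^ m
    e₁ = trans (sym (#-split (twist f (false ∷ δ))))
               (balanced⇒half (twist f (false ∷ δ)) (balanced (false ∷ δ) (δ≢𝟘 ∘ cong tail)))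
    e₂ : # (twist f₀ δ) + # (not ∘ twist f₁ δ) ≡ 2 ^ m
    e₂ = trans (cong (# (twist f₀ δ) +_) (#-cong λ x → not-distribʳ-xor (f₁ x) (dot δ x)))
               (trans (sym (#-split (twist f (true ∷ δ))))
                      (balanced⇒half (twist f (true ∷ δ)) (balanced (true ∷ δ) (δ≢𝟘 ∘ cong tail))))
  f₀-constant = balanced-twists⇒constant m f₀ λ δ δ≢𝟘 → proj₁ (halves δ δ≢𝟘)
  f₁-constant = balanced-twists⇒constant m f₁ λ δ δ≢𝟘 → proj₂ (halves δ δ≢𝟘)
  a = proj₁ f₀-constant
  b = proj₁ f₁-constant
  f₀≡a = proj₂ f₀-constant
  f₁≡b = proj₂ f₁-constant
  a≡b : a ≡ b
  a≡b = halves-agree m a b (begin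
    # (λ (_ : Pt m) → a) + # (λ (_ : Pt m) → not b)
                                    ≡⟨ cong₂ _+_ (#-cong (sym ∘ left≡a)) (#-cong (sym ∘ right≡not-b)) ⟩
    # left + # right                ≡⟨ sym (#-split (twist f (true ∷ 𝟘 m))) ⟩
    # (twist f (true ∷ 𝟘 m))        ≡⟨ balanced⇒half (twist f (true ∷ 𝟘 m)) (balanced (true ∷ 𝟘 m) λ ()) ⟩
    2 ^ m                           ∎)
    where
    left right : Pt m → Bool
    left x = f₀ x xor dot (𝟘 m) x
    right x = f₁ x xor not (dot (𝟘 m) x)
    left≡a : ∀ x → left x ≡ a
    left≡a x = trans (cong (f₀ x xor_) (dot-𝟘 x)) (trans (xor-identityʳ _) (f₀≡a x))
    right≡not-b : ∀ x → right x ≡ not b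
    right≡not-b x = trans (cong (λ d → f₁ x xor not d) (dot-𝟘 x)) (trans (xor-comm _ true) (cong not (f₁≡b x)))

SpectralCondition : {k : ℕ} → (Pt k → Bool) → Set
SpectralCondition {k} h =
  (∀ γ γ′ → ExtremeCount (twist h γ) → ExtremeCount (twist h γ′) → γ ≡ γ′)
  × (∀ γ′ → ¬ ExtremeCount (twist h γ′) → # twist h γ′ ≡ 2 ^ (k ∸ 1))

-- An affine h = L·X ⊕ c satisfies it: the twist by γ is the affine form
-- (L ⊕ γ)·X ⊕ c, which is constant for γ = L and balanced for γ ≠ L.
affine⇒spectral : ∀ {m} (h : Pt (suc m) → Bool) → Affine h → SpectralCondition h
affine⇒spectral {m} h (L , c , hL≡c) = unique , balanced-elsewhere
  where
  constant-at-L : ∀ γ → L ⊕ γ ≡ 𝟘 (suc m) → Constant (twist h γ)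
  constant-at-L γ L⊕γ≡𝟘 = c , λ x → begin
    twist h γ x               ≡⟨ twist-affine h L hL≡c γ x ⟩
    dot (L ⊕ γ) x xor c       ≡⟨ cong (λ δ → dot δ x xor c) L⊕γ≡𝟘 ⟩
    dot (𝟘 (suc m)) x xor c   ≡⟨ cong (_xor c) (dot-𝟘 x) ⟩
    c                         ∎
  balanced-off-L : ∀ γ → L ⊕ γ ≢ 𝟘 (suc m) → Balanced (twist h γ)
  balanced-off-L γ L⊕γ≢𝟘 = balanced-cong (twist-affine h L hL≡c γ) (linear-balanced (L ⊕ γ) c L⊕γ≢𝟘)
  extreme⇒L⊕γ≡𝟘 : ∀ γ → ExtremeCount (twist h γ) → L ⊕ γ ≡ 𝟘 (suc m)
  extreme⇒L⊕γ≡𝟘 γ extreme with ≡-dec _≟_ (L ⊕ γ) (𝟘 (suc m))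
  ... | yes L⊕γ≡𝟘 = L⊕γ≡𝟘
  ... | no L⊕γ≢𝟘 = ⊥-elim (balanced⇒¬extreme (twist h γ) (balanced-off-L γ L⊕γ≢𝟘) extreme)
  unique : ∀ γ γ′ → ExtremeCount (twist h γ) → ExtremeCount (twist h γ′) → γ ≡ γ′
  unique γ γ′ e e′ = ⊕-cancelˡ L γ γ′ (trans (extreme⇒L⊕γ≡𝟘 γ e) (sym (extreme⇒L⊕γ≡𝟘 γ′ e′)))
  balanced-elsewhere : ∀ γ → ¬ ExtremeCount (twist h γ) → # twist h γ ≡ 2 ^ m
  balanced-elsewhere γ ¬extreme with ≡-dec _≟_ (L ⊕ γ) (𝟘 (suc m))
  ... | yes L⊕γ≡𝟘 = ⊥-elim (¬extreme (constant⇒extreme (constant-at-L γ L⊕γ≡𝟘)))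
  ... | no L⊕γ≢𝟘 = balanced⇒half (twist h γ) (balanced-off-L γ L⊕γ≢𝟘)

-- Conversely, a function satisfying the condition is affine: if γ* is a twist
-- with extreme count, all twists of h ⊕ γ*·X by δ ≠ 0 are balanced, so
-- h ⊕ γ*·X is constant; and some extreme twist must exist, since otherwise h
-- itself would be constant.
spectral⇒affine : ∀ {m} (h : Pt (suc m) → Bool) → SpectralCondition h → Affine h
spectral⇒affine {m} h (unique , balanced-elsewhere)
  with any? (λ γ → extreme? (twist h γ)) (allPts (suc m))
... | yes some-extreme = γ* , balanced-twists⇒constant (suc m) (twist h γ*) twists-balanced
  where
  γ* = proj₁ (satisfied some-extreme)
  γ*-extreme = proj₂ (satisfied some-extreme)
  -- Every γ ≠ γ* is non-extreme, hence balanced; write γ = γ* ⊕ δ with δ ≠ 0.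
  twists-balanced : ∀ δ → δ ≢ 𝟘 (suc m) → Balanced (twist (twist h γ*) δ)
  twists-balanced δ δ≢𝟘 = balanced-cong (twist-twist h γ* δ)
    (cong (2 *_) (balanced-elsewhere (γ* ⊕ δ) λ extreme →
      δ≢𝟘 (⊕-cancelˡ γ* δ (𝟘 (suc m))
        (trans (sym (unique γ* (γ* ⊕ δ) γ*-extreme extreme)) (sym (zipWith-identityʳ xor-identityʳ γ*))))))
... | no none-extreme = ⊥-elim (¬extreme (𝟘 (suc m)) (constant⇒extreme (c , λ x →
        trans (cong (h x xor_) (dot-𝟘 x)) (trans (xor-identityʳ (h x)) (h≡c x)))))
  where
  ¬extreme : ∀ γ → ¬ ExtremeCount (twist h γ)
  ¬extreme γ extreme = none-extreme (lose (allPts-complete γ) extreme)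
  -- With no extreme twist at all, every nontrivial twist is balanced, so h is constant
  -- and then its trivial twist is extreme after all.
  h-constant = balanced-twists⇒constant (suc m) h λ δ _ → cong (2 *_) (balanced-elsewhere δ (¬extreme δ))
  c = proj₁ h-constant
  h≡c = proj₂ h-constant

⨁ : {A : Set} → (A → Bool) → List A → Bool
⨁ h xs = foldr _xor_ false (map h xs)

⨁-++ : {A : Set} (h : A → Bool) (xs ys : List A) → ⨁ h (xs ++ ys) ≡ ⨁ h xs xor ⨁ h ys
⨁-++ h [] ys = refl
⨁-++ h (x ∷ xs) ys = trans (cong (h x xor_) (⨁-++ h xs ys)) (sym (xor-assoc (h x) _ _))

⨁-map : {A B : Set} (h : B → Bool) (f : A → B) (xs : List A) → ⨁ h (map f xs) ≡ ⨁ (h ∘ f) xs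
⨁-map h f xs = cong (foldr _xor_ false) (sym (map-∘ xs))

⨁-cong : {A : Set} {h h′ : A → Bool} → (∀ x → h x ≡ h′ x) → (xs : List A) → ⨁ h xs ≡ ⨁ h′ xs
⨁-cong eq xs = cong (foldr _xor_ false) (map-cong eq xs)

⨁-∧ : {A : Set} (y : Bool) (h : A → Bool) (xs : List A) → ⨁ (λ a → y ∧ h a) xs ≡ y ∧ ⨁ h xs
⨁-∧ y h [] = sym (∧-zeroʳ y)
⨁-∧ y h (x ∷ xs) = trans (cong ((y ∧ h x) xor_) (⨁-∧ y h xs)) (sym (∧-distribˡ-xor y (h x) _))

-- The decomposition g = low g ⊕ X₁ · high g along the first variable.
low high : ∀ {k} → Poly (suc k) → Poly k
low g S = g (false ∷ S)
high g S = g (true ∷ S)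

eval-split : ∀ {k} (g : Poly (suc k)) y x → eval g (y ∷ x) ≡ eval (low g) x xor (y ∧ eval (high g) x)
eval-split {k} g y x = begin
  ⨁ F (map (false ∷_) Ss ++ map (true ∷_) Ss)          ≡⟨ ⨁-++ F (map (false ∷_) Ss) _ ⟩
  ⨁ F (map (false ∷_) Ss) xor ⨁ F (map (true ∷_) Ss)  ≡⟨ cong₂ _xor_ (⨁-map F _ Ss) (⨁-map F _ Ss) ⟩
  eval (low g) x xor ⨁ (F ∘ (true ∷_)) Ss              ≡⟨ cong (eval (low g) x xor_) (⨁-cong pull-y Ss) ⟩
  eval (low g) x xor ⨁ (λ S → y ∧ (high g S ∧ monoEval S x)) Ss ≡⟨ cong (eval (low g) x xor_) (⨁-∧ y _ Ss) ⟩
  eval (low g) x xor (y ∧ eval (high g) x)              ∎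
  where
  Ss = allPts k
  F = λ S → g S ∧ monoEval S (y ∷ x)
  pull-y : ∀ S → F (true ∷ S) ≡ y ∧ (high g S ∧ monoEval S x)
  pull-y S = solve 3 (λ a y m → a :* (y :* m) := y :* (a :* m)) refl (high g S) y (monoEval S x)

eval-low : ∀ {k} (g : Poly (suc k)) x → eval g (false ∷ x) ≡ eval (low g) x
eval-low g x = trans (eval-split g false x) (xor-identityʳ _)

eval-high : ∀ {k} (g : Poly (suc k)) x → eval (high g) x ≡ eval g (false ∷ x) xor eval g (true ∷ x)
eval-high g x = sym (begin
  eval g (false ∷ x) xor eval g (true ∷ x)   ≡⟨ cong₂ _xor_ (eval-low g x) (eval-split g true x) ⟩
  e₀ xor (e₀ xor eval (high g) x)             ≡⟨ solve 2 (λ p q → p :+ (p :+ q) := q) refl e₀ _ ⟩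
  eval (high g) x                             ∎)
  where e₀ = eval (low g) x

eval-nullary : (g : Poly 0) → eval g [] ≡ g []
eval-nullary g = solve 1 (λ a → (a :* con true) :+ con false := a) refl (g [])

eval-zero : ∀ {k} (g : Poly k) → (∀ S → g S ≡ false) → ∀ x → eval g x ≡ false
eval-zero {k} g g≡0 x = trans (⨁-cong (λ S → cong (_∧ monoEval S x) (g≡0 S)) (allPts k))
                              (⨁-∧ false (λ S → monoEval S x) (allPts k))

low-degree : ∀ {k d} (g : Poly (suc k)) → DegreeAtMost d g → DegreeAtMost d (low g)
low-degree g deg S = deg (false ∷ S)

high-degree : ∀ {k d} (g : Poly (suc k)) → DegreeAtMost (suc d) g → DegreeAtMost d (high g)
high-degree g deg S gS = s≤s⁻¹ (deg (true ∷ S) gS)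

high-vanishes : ∀ {k} (g : Poly (suc k)) → DegreeAtMost 0 g → ∀ S → high g S ≡ false
high-vanishes g deg S with high g S in gS
... | false = refl
... | true with deg (true ∷ S) gS
...   | ()

degree-join : ∀ {k d} (g : Poly (suc k)) → DegreeAtMost (suc d) (low g) → DegreeAtMost d (high g) →
              DegreeAtMost (suc d) g
degree-join g low-deg high-deg (false ∷ S) = low-deg S
degree-join g low-deg high-deg (true ∷ S) gS = s≤s (high-deg S gS)

degree-join₀ : ∀ {k} (g : Poly (suc k)) → DegreeAtMost 0 (low g) → (∀ S → high g S ≡ false) →
               DegreeAtMost 0 g
degree-join₀ g low-deg high≡0 (false ∷ S) = low-deg S
degree-join₀ g low-deg high≡0 (true ∷ S) gS with trans (sym gS) (high≡0 S)
... | ()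

degree-nullary : ∀ d (g : Poly 0) → DegreeAtMost d g
degree-nullary d g [] _ = z≤n

Δ : ∀ {k} → Poly k → Pt k → Pt k → Pt k → Bool
Δ g α β x = eval g (α ⊕ x) xor eval g (β ⊕ x)

Δ-low : ∀ {k} (g : Poly (suc k)) α β x → Δ (low g) α β x ≡ Δ g (false ∷ α) (false ∷ β) (false ∷ x)
Δ-low g α β x = sym (cong₂ _xor_ (eval-low g (α ⊕ x)) (eval-low g (β ⊕ x)))

Δ-high : ∀ {k} (g : Poly (suc k)) α β x →
         Δ (high g) α β x ≡ Δ g (false ∷ α) (false ∷ β) (false ∷ x) xor Δ g (false ∷ α) (false ∷ β) (true ∷ x)
Δ-high g α β x = trans (cong₂ _xor_ (eval-high g (α ⊕ x)) (eval-high g (β ⊕ x)))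
  (solve 4 (λ p q r s → (p :+ q) :+ (r :+ s) := (p :+ r) :+ (q :+ s)) refl
    (eval g (false ∷ (α ⊕ x))) (eval g (true ∷ (α ⊕ x))) (eval g (false ∷ (β ⊕ x))) (eval g (true ∷ (β ⊕ x))))

Δ-diagonal-affine : ∀ {k} (g : Poly k) α → Affine (Δ g α α)
Δ-diagonal-affine {k} g α = 𝟘 k , false , λ x → cong₂ _xor_ (xor-same (eval g (α ⊕ x))) (dot-𝟘 x)

degree0⇒constant : ∀ {k} (g : Poly k) → DegreeAtMost 0 g → Constant (eval g)
degree0⇒constant {zero} g _ = constant-on-Pt0 (eval g)
degree0⇒constant {suc k} g deg = c , λ { (y ∷ x) → begin
  eval g (y ∷ x)                              ≡⟨ eval-split g y x ⟩
  eval (low g) x xor (y ∧ eval (high g) x)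
    ≡⟨ cong₂ (λ a b → a xor (y ∧ b)) (low≡c x) (eval-zero (high g) (high-vanishes g deg) x) ⟩
  c xor (y ∧ false)                           ≡⟨ cong (c xor_) (∧-zeroʳ y) ⟩
  c xor false                                 ≡⟨ xor-identityʳ c ⟩
  c                                           ∎ }
  where
  c = proj₁ (degree0⇒constant (low g) (low-degree g deg))
  low≡c = proj₂ (degree0⇒constant (low g) (low-degree g deg))

degree1⇒affine : ∀ {k} (g : Poly k) → DegreeAtMost 1 g → Affine (eval g)
degree1⇒affine {zero} g _ = affine-on-Pt0 (eval g)
degree1⇒affine {suc k} g deg with degree1⇒affine (low g) (low-degree g deg) | degree0⇒constant (high g) (high-degree g deg)
... | L , c , lowL≡c | c₁ , high≡c₁ = c₁ ∷ L , c , λ { (y ∷ x) → begin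
  eval g (y ∷ x) xor ((c₁ ∧ y) xor dot L x)
    ≡⟨ cong (_xor ((c₁ ∧ y) xor dot L x))
            (trans (eval-split g y x) (cong (λ b → eval (low g) x xor (y ∧ b)) (high≡c₁ x))) ⟩
  (eval (low g) x xor (y ∧ c₁)) xor ((c₁ ∧ y) xor dot L x)
    ≡⟨ solve 4 (λ e y c d → (e :+ (y :* c)) :+ ((c :* y) :+ d) := e :+ d) refl (eval (low g) x) y c₁ (dot L x) ⟩
  eval (low g) x xor dot L x
    ≡⟨ lowL≡c x ⟩
  c ∎ }

-- Splitting off X₁,
-- Δ g = Δ (low g) ⊕ (α₁ ⊕ X₁)·high g(α ⊕ X) ⊕ (β₁ ⊕ X₁)·high g(β ⊕ X) with
-- high g affine; the quadratic terms X₁·(L₁·X) of the last two summands cancel.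
degree2⇒affine-derivatives : ∀ {k} (g : Poly k) → DegreeAtMost 2 g → ∀ α β → Affine (Δ g α β)
degree2⇒affine-derivatives {zero} g _ α β = affine-on-Pt0 (Δ g α β)
degree2⇒affine-derivatives {suc k} g deg (a ∷ α) (b ∷ β)
  with degree2⇒affine-derivatives (low g) (low-degree g deg) α β | degree1⇒affine (high g) (high-degree g deg)
... | L₀ , c₀ , Δ₀L₀≡c₀ | L₁ , c₁ , highL₁≡c₁ =
  (p xor q) ∷ (L₀ ⊕ scale (a xor b) L₁) , c₀ xor ((a ∧ p) xor (b ∧ q)) , λ { (y ∷ x) → begin
    twist (Δ g (a ∷ α) (b ∷ β)) ((p xor q) ∷ (L₀ ⊕ scale (a xor b) L₁)) (y ∷ x)
      ≡⟨ cong₂ _xor_ (cong₂ _xor_ (restrict (a xor y) α x) (restrict (b xor y) β x))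
                     (cong (((p xor q) ∧ y) xor_)
                           (trans (dot-⊕ˡ L₀ _ x) (cong (dot L₀ x xor_) (dot-scale (a xor b) L₁ x)))) ⟩
    ((E₀ α x xor ((a xor y) ∧ (dot L₁ x xor p))) xor (E₀ β x xor ((b xor y) ∧ (dot L₁ x xor q))))
      xor (((p xor q) ∧ y) xor (dot L₀ x xor ((a xor b) ∧ dot L₁ x)))
      ≡⟨ solve 9 (λ e f l₀ l₁ a b y p q →
           ((e :+ ((a :+ y) :* (l₁ :+ p))) :+ (f :+ ((b :+ y) :* (l₁ :+ q))))
             :+ (((p :+ q) :* y) :+ (l₀ :+ ((a :+ b) :* l₁)))
           := ((e :+ f) :+ l₀) :+ ((a :* p) :+ (b :* q)))
         refl (E₀ α x) (E₀ β x) (dot L₀ x) (dot L₁ x) a b y p q ⟩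
    twist (Δ (low g) α β) L₀ x xor ((a ∧ p) xor (b ∧ q))
      ≡⟨ cong (_xor ((a ∧ p) xor (b ∧ q))) (Δ₀L₀≡c₀ x) ⟩
    c₀ xor ((a ∧ p) xor (b ∧ q)) ∎ }
  where
  -- high g (u ⊕ x) = L₁·x ⊕ (L₁·u ⊕ c₁); p and q are its constant parts at α and β.
  p = dot L₁ α xor c₁
  q = dot L₁ β xor c₁
  E₀ : Pt k → Pt k → Bool
  E₀ u x = eval (low g) (u ⊕ x)
  restrict : ∀ s u x → eval g (s ∷ (u ⊕ x)) ≡ E₀ u x xor (s ∧ (dot L₁ x xor (dot L₁ u xor c₁)))
  restrict s u x = trans (eval-split g s (u ⊕ x))
    (cong (λ t → E₀ u x xor (s ∧ t)) (affine-translate (eval (high g)) L₁ highL₁≡c₁ u x))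

vanishing⇒zero : ∀ {k} (g : Poly k) → (∀ x → eval g x ≡ false) → ∀ S → g S ≡ false
vanishing⇒zero {zero} g g≡0 [] = trans (sym (eval-nullary g)) (g≡0 [])
vanishing⇒zero {suc k} g g≡0 (false ∷ S) =
  vanishing⇒zero (low g) (λ x → trans (sym (eval-low g x)) (g≡0 (false ∷ x))) S
vanishing⇒zero {suc k} g g≡0 (true ∷ S) =
  vanishing⇒zero (high g) (λ x → trans (eval-high g x) (cong₂ _xor_ (g≡0 (false ∷ x)) (g≡0 (true ∷ x)))) S

-- Conversely, constant polynomials have degree ≤ 0, polynomials with constant
-- derivatives degree ≤ 1, and polynomials with affine derivatives degree ≤ 2:
-- the hypothesis passes to low g, and to high g one derivative down.
constant⇒degree0 : ∀ {k} (g : Poly k) → Constant (eval g) → DegreeAtMost 0 g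
constant⇒degree0 {zero} g _ = degree-nullary 0 g
constant⇒degree0 {suc k} g (c , g≡c) = degree-join₀ g
  (constant⇒degree0 (low g) (c , λ x → trans (sym (eval-low g x)) (g≡c (false ∷ x))))
  (vanishing⇒zero (high g) λ x →
    trans (eval-high g x) (trans (cong₂ _xor_ (g≡c (false ∷ x)) (g≡c (true ∷ x))) (xor-same c)))

constant-derivatives⇒degree1 : ∀ {k} (g : Poly k) → (∀ α β → Constant (Δ g α β)) → DegreeAtMost 1 g
constant-derivatives⇒degree1 {zero} g _ = degree-nullary 1 g
constant-derivatives⇒degree1 {suc k} g Δ-constant = degree-join g
  (constant-derivatives⇒degree1 (low g) λ α β →
    let (c , Δ≡c) = Δ-constant (false ∷ α) (false ∷ β) in c , λ x → trans (Δ-low g α β x) (Δ≡c (false ∷ x)))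
  (constant⇒degree0 (high g) (c , λ x → trans (high-as-Δ x) (Δ≡c (false ∷ x))))
  where
  c = proj₁ (Δ-constant (false ∷ 𝟘 k) (true ∷ 𝟘 k))
  Δ≡c = proj₂ (Δ-constant (false ∷ 𝟘 k) (true ∷ 𝟘 k))
  high-as-Δ : ∀ x → eval (high g) x ≡ Δ g (false ∷ 𝟘 k) (true ∷ 𝟘 k) (false ∷ x)
  high-as-Δ x = trans (eval-high g x)
    (cong (λ z → eval g (false ∷ z) xor eval g (true ∷ z)) (sym (zipWith-identityˡ xor-identityˡ x)))

affine-derivatives⇒degree2 : ∀ {k} (g : Poly k) → (∀ α β → Affine (Δ g α β)) → DegreeAtMost 2 g
affine-derivatives⇒degree2 {zero} g _ = degree-nullary 2 g
affine-derivatives⇒degree2 {suc k} g Δ-affine = degree-join g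
  (affine-derivatives⇒degree2 (low g) λ α β →
    affine-cong (Δ-low g α β) (affine-restrict (Δ g (false ∷ α) (false ∷ β)) (Δ-affine (false ∷ α) (false ∷ β))))
  (constant-derivatives⇒degree1 (high g) λ α β →
    let (c , Δ≡c) = affine-difference (Δ g (false ∷ α) (false ∷ β)) (Δ-affine (false ∷ α) (false ∷ β)) in
    c , λ x → trans (Δ-high g α β x) (Δ≡c x))

mainTheorem7 : (k : ℕ) (g : Poly k) →
    DegreeAtMost 2 g ⇔
      (∀ (α β : Pt k) → α ≢ β →
        (∀ γ γ′ → Extreme g α β γ → Extreme g α β γ′ → γ ≡ γ′)
        × (∀ γ′ → ¬ Extreme g α β γ′ → # gabc g α β γ′ ≡ 2 ^ (k ∸ 1)))
mainTheorem7 zero g = mk⇔ (λ { _ [] [] α≢β → ⊥-elim (α≢β refl) }) (λ _ → degree-nullary 2 g)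
mainTheorem7 (suc m) g = mk⇔
  (λ deg α β _ → affine⇒spectral (Δ g α β) (degree2⇒affine-derivatives g deg α β))
  (λ spectral → affine-derivatives⇒degree2 g λ α β → Δ-affine spectral α β)
  where
  Δ-affine : (∀ α β → α ≢ β → SpectralCondition (Δ g α β)) → ∀ α β → Affine (Δ g α β)
  Δ-affine spectral α β with ≡-dec _≟_ α β
  ... | yes refl = Δ-diagonal-affine g α
  ... | no α≢β = spectral⇒affine (Δ g α β) (spectral α β α≢β)
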